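{- For $n\ge1$ let $\Gamma_n^3$ be the graph with vertices $x_i,y_i,z_i$ ($1\le i\le n$) and edges $\{x_i,y_i\},\{y_i,z_i\},\{z_i,x_i\}$ for $1\le i\le n$, and $\{x_i,x_{i+1}\},\{y_i,y_{i+1}\},\{z_i,z_{i+1}\},\{x_i,y_{i+1}\},\{y_i,z_{i+1}\},\{z_i,x_{i+1}\}$ for $1\le i\le n-1$. Let $E_n^3=\sum_{\chi}(-1)^{|\chi|}$, the sum over all configurations $\chi$ of $\Gamma_n^3$. Then $$E_n^3=(E_1^3)^{\lfloor (n+1)/2\rfloor}=(-2)^{\lfloor (n+1)/2\rfloor}.$$
   Context: A configuration of a graph is a set of vertices (including the empty set) no two of which are joined by an edge. $\Gamma_n^3$ is the cyclic 3-leg triangular ladder with $n$ columns (column $i$ being $\{x_i,y_i,z_i\}$). $E_n^3$ equals the Euler characteristic of the complex formed by the fermion algebra of $\Gamma_n^3$ (anticommuting generators $\psi_v$ for the vertices, with $\psi_u\psi_v=0$ for edges $\{u,v\}$) with differential given by multiplication by $\sum_v\psi_v$. -}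

module Defs where

open import Data.Nat using (ℕ; zero; suc)
open import Data.Integer using (ℤ; +_; -_; _*_; _+_)
open import Data.Integer.Base using (-1ℤ)
open import Data.Fin using (Fin; zero; suc; toℕ)
open import Data.Fin.Subset using (Subset; _∈_; ∣_∣)
open import Data.Fin.Subset.Properties using (_∈?_)
open import Data.Fin.Properties using (all?) renaming (_≟_ to _≟F_)
open import Data.Nat.Properties using () renaming (_≟_ to _≟ℕ_)
open import Data.Bool using (Bool; true; false)
open import Data.Vec using (Vec; []; _∷_; lookup)
open import Data.List using (List; []; _∷_; map; concatMap; filter; foldr)
open import Data.Product using (_×_; _,_)
open import Data.Sum using (_⊎_)
open import Relation.Nullary using (¬_; Dec)
open import Relation.Nullary.Decidable using (¬?; _×-dec_; _⊎-dec_; _→-dec_; map′)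
open import Relation.Binary.PropositionalEquality using (_≡_; _≢_)

-- Vertices of Γ_n^3: column i (0-based, i < n) and row c ∈ {0,1,2} = {x,y,z}.
Vertex : ℕ → Set
Vertex n = Fin n × Fin 3

next : Fin 3 → Fin 3
next zero = suc zero
next (suc zero) = suc (suc zero)
next (suc (suc zero)) = zero

-- directed "forward" edges from (i , c) to (j , d):
--   rungs within a column: c ≠ d, i = j (the triangle x_i y_i z_i)
--   legs x_i x_{i+1}, y_i y_{i+1}, z_i z_{i+1}: j = i+1, d = c
--   diagonals x_i y_{i+1}, y_i z_{i+1}, z_i x_{i+1}: j = i+1, d = next c
Forward : ∀ {n} → Vertex n → Vertex n → Set
Forward (i , c) (j , d) = toℕ j ≡ suc (toℕ i) × (d ≡ c ⊎ d ≡ next c)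

Adj : ∀ {n} → Vertex n → Vertex n → Set
Adj (i , c) (j , d) = (i ≡ j × c ≢ d) ⊎ Forward (i , c) (j , d) ⊎ Forward (j , d) (i , c)

adj? : ∀ {n} (u v : Vertex n) → Dec (Adj u v)
adj? (i , c) (j , d) =
  ((i ≟F j) ×-dec ¬? (c ≟F d))
  ⊎-dec (((toℕ j ≟ℕ suc (toℕ i)) ×-dec ((d ≟F c) ⊎-dec (d ≟F next c)))
  ⊎-dec ((toℕ i ≟ℕ suc (toℕ j)) ×-dec ((c ≟F d) ⊎-dec (c ≟F next d))))

VSet : ℕ → Set
VSet n = Vec (Subset 3) n

_∈V_ : ∀ {n} → Vertex n → VSet n → Set
(i , c) ∈V χ = c ∈ lookup χ i

_∈V?_ : ∀ {n} (v : Vertex n) (χ : VSet n) → Dec (v ∈V χ)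
(i , c) ∈V? χ = c ∈? lookup χ i

size : ∀ {n} → VSet n → ℕ
size [] = 0
size (s ∷ χ) = ∣ s ∣ Data.Nat.+ size χ

IsConfiguration : ∀ {n} → VSet n → Set
IsConfiguration χ = ∀ u v → u ∈V χ → v ∈V χ → ¬ Adj u v

isConfiguration? : ∀ {n} (χ : VSet n) → Dec (IsConfiguration χ)
isConfiguration? χ =
  allV? λ u → allV? λ v → (u ∈V? χ) →-dec ((v ∈V? χ) →-dec ¬? (adj? u v))
  where
  allV? : ∀ {n} {P : Vertex n → Set} → (∀ v → Dec (P v)) → Dec (∀ v → P v)
  allV? P? = map′ (λ h → λ { (i , c) → h i c }) (λ h i c → h (i , c))
                  (all? λ i → all? λ c → P? (i , c))

allVecs : ∀ {A : Set} → List A → (n : ℕ) → List (Vec A n)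
allVecs xs zero = [] ∷ []
allVecs xs (suc n) = concatMap (λ x → map (x ∷_) (allVecs xs n)) xs

allSubsets3 : List (Subset 3)
allSubsets3 = allVecs (false ∷ true ∷ []) 3

allVSets : (n : ℕ) → List (VSet n)
allVSets n = allVecs allSubsets3 n

sign : ℕ → ℤ
sign zero = + 1
sign (suc k) = - sign k

E3 : ℕ → ℤ
E3 n = foldr _+_ (+ 0) (map (λ χ → sign (size χ)) (filter isConfiguration? (allVSets n)))

module Submission where

open import Defs
open import Data.Nat using (ℕ; suc; _≥_; _/_)
open import Data.Integer using (ℤ; -_; +_; _^_)
open import Relation.Binary.PropositionalEquality using (_≡_)
open import Data.Product using (_×_)

open import Data.Bool using (true; false; _∧_; if_then_else_)
open import Data.Empty using (⊥-elim)
open import Data.Fin using (Fin; zero; suc)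
import Data.Fin.Properties as Fin
open import Data.Fin.Subset using (Subset; _∈_; ∣_∣; ⁅_⁆) renaming (⊥ to ∅)
open import Data.Fin.Subset.Properties using (_∈?_; ∉⊥)
open import Data.Integer using (0ℤ; -1ℤ; _+_; _*_; _-_)
import Data.Integer.Properties as ℤ
open import Data.Integer.Tactic.RingSolver using (solve-∀)
open import Data.List using (List; []; _∷_; map; concatMap; filter; foldr; _++_)
import Data.Nat as ℕ
import Data.Nat.DivMod as ℕ
import Data.Nat.Properties as ℕ
open import Data.Product using (_,_)
open import Data.Sum using (_⊎_; inj₁; inj₂)
open import Data.Unit using (⊤; tt)
open import Data.Vec using (Vec; []; _∷_)
open import Function using (_∘_)
open import Function.Bundles using (_⇔_; mk⇔)
open import Relation.Nullary using (¬_; Dec; yes; no; does)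
open import Relation.Nullary.Decidable using (¬?; _×-dec_; _⊎-dec_; _→-dec_; dec-true; does-⇔)
open import Relation.Binary.PropositionalEquality using (refl; sym; trans; cong; cong₂; module ≡-Reasoning)

-- Transfer matrix.  A column of Γ_n^3 is a triangle, so a configuration has at
-- most one vertex per column; sort configurations by their first column.
-- Writing E(s, n) for the signed count of configurations of n columns that may
-- follow a column s, E(∅, n+1) = E(∅, n) - E(x, n) - E(y, n) - E(z, n) and
-- E(x, n+1) = E(∅, n) - E(z, n), cyclically in x, y, z.  Substituting the
-- second recurrence into the first, the singleton terms cancel, leaving
-- E_{n+2}^3 = E(∅, n+2) = -2 E(∅, n) = -2 E_n^3.

∑ : ∀ {A : Set} → List A → (A → ℤ) → ℤ
∑ xs f = foldr _+_ 0ℤ (map f xs)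

private variable
  A B : Set

∑-cong : ∀ {f g : A → ℤ} xs → (∀ x → f x ≡ g x) → ∑ xs f ≡ ∑ xs g
∑-cong []       f≗g = refl
∑-cong (x ∷ xs) f≗g = cong₂ _+_ (f≗g x) (∑-cong xs f≗g)

∑-++ : ∀ (f : A → ℤ) xs ys → ∑ (xs ++ ys) f ≡ ∑ xs f + ∑ ys f
∑-++ f []       ys = sym (ℤ.+-identityˡ _)
∑-++ f (x ∷ xs) ys = trans (cong (_+_ (f x)) (∑-++ f xs ys)) (sym (ℤ.+-assoc (f x) _ _))

∑-*ˡ : ∀ k (f : A → ℤ) xs → ∑ xs (λ x → k * f x) ≡ k * ∑ xs f
∑-*ˡ k f []       = sym (ℤ.*-zeroʳ k)
∑-*ˡ k f (x ∷ xs) = trans (cong (_+_ (k * f x)) (∑-*ˡ k f xs)) (sym (ℤ.*-distribˡ-+ k (f x) _))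

∑-if : ∀ b (f : A → ℤ) xs → ∑ xs (λ x → if b then f x else 0ℤ) ≡ (if b then ∑ xs f else 0ℤ)
∑-if true  f xs       = refl
∑-if false f []       = refl
∑-if false f (x ∷ xs) = trans (ℤ.+-identityˡ _) (∑-if false f xs)

∑-filter : ∀ {P : A → Set} (P? : ∀ x → Dec (P x)) (f : A → ℤ) xs →
           ∑ (filter P? xs) f ≡ ∑ xs (λ x → if does (P? x) then f x else 0ℤ)
∑-filter P? f []       = refl
∑-filter P? f (x ∷ xs) with does (P? x)
... | true  = cong (_+_ (f x)) (∑-filter P? f xs)
... | false = trans (∑-filter P? f xs) (sym (ℤ.+-identityˡ _))

∑-concatMap : ∀ (g : A → List B) (f : B → ℤ) xs →
              ∑ (concatMap g xs) f ≡ ∑ xs (λ x → ∑ (g x) f)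
∑-concatMap g f []       = refl
∑-concatMap g f (x ∷ xs) =
  trans (∑-++ f (g x) (concatMap g xs)) (cong (_+_ (∑ (g x) f)) (∑-concatMap g f xs))

∑-map : ∀ (g : A → B) (f : B → ℤ) xs → ∑ (map g xs) f ≡ ∑ xs (f ∘ g)
∑-map g f []       = refl
∑-map g f (x ∷ xs) = cong (_+_ (f (g x))) (∑-map g f xs)

∑-allVecs-suc : ∀ (xs : List A) n (f : Vec A (suc n) → ℤ) →
                ∑ (allVecs xs (suc n)) f ≡ ∑ xs (λ x → ∑ (allVecs xs n) (λ v → f (x ∷ v)))
∑-allVecs-suc xs n f = trans (∑-concatMap (λ x → map (x ∷_) (allVecs xs n)) f xs)
                             (∑-cong xs (λ x → ∑-map (x ∷_) f (allVecs xs n)))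

if-∧-* : ∀ a b c (x y : ℤ) →
         (if a ∧ (b ∧ c) then x * y else 0ℤ) ≡ (if a ∧ b then x * (if c then y else 0ℤ) else 0ℤ)
if-∧-* false b     c     x y = refl
if-∧-* true  false c     x y = refl
if-∧-* true  true  true  x y = refl
if-∧-* true  true  false x y = sym (ℤ.*-zeroʳ x)

sign-+ : ∀ m n → sign (m ℕ.+ n) ≡ sign m * sign n
sign-+ 0       n = sym (ℤ.*-identityˡ _)
sign-+ (suc m) n = trans (cong -_ (sign-+ m n)) (ℤ.neg-distribˡ-* (sign m) (sign n))

AtMostOne : Subset 3 → Set
AtMostOne s = ∀ c d → c ∈ s → d ∈ s → c ≡ d

NoForwardEdge : Subset 3 → Subset 3 → Set
NoForwardEdge s t = ∀ c d → c ∈ s → d ∈ t → ¬ (d ≡ c ⊎ d ≡ next c)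

CanPrecede : ∀ {n} → Subset 3 → VSet n → Set
CanPrecede s []      = ⊤
CanPrecede s (t ∷ _) = NoForwardEdge s t

atMostOne? : ∀ s → Dec (AtMostOne s)
atMostOne? s = Fin.all? λ c → Fin.all? λ d → (c ∈? s) →-dec ((d ∈? s) →-dec (c Fin.≟ d))

noForwardEdge? : ∀ s t → Dec (NoForwardEdge s t)
noForwardEdge? s t = Fin.all? λ c → Fin.all? λ d →
  (c ∈? s) →-dec ((d ∈? t) →-dec ¬? ((d Fin.≟ c) ⊎-dec (d Fin.≟ next c)))

canPrecede? : ∀ {n} s (χ : VSet n) → Dec (CanPrecede s χ)
canPrecede? s []      = yes tt
canPrecede? s (t ∷ _) = noForwardEdge? s t

∅-canPrecede : ∀ {n} (χ : VSet n) → CanPrecede ∅ χ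
∅-canPrecede []      = tt
∅-canPrecede (t ∷ _) c d c∈∅ = ⊥-elim (∉⊥ c∈∅)

Adj-suc : ∀ {n} {i j : Fin n} {c d} → Adj (i , c) (j , d) → Adj {suc n} (suc i , c) (suc j , d)
Adj-suc (inj₁ (refl , c≢d))        = inj₁ (refl , c≢d)
Adj-suc (inj₂ (inj₁ (j≡1+i , e))) = inj₂ (inj₁ (cong suc j≡1+i , e))
Adj-suc (inj₂ (inj₂ (i≡1+j , e))) = inj₂ (inj₂ (cong suc i≡1+j , e))

Adj-pred : ∀ {n} {i j : Fin n} {c d} → Adj {suc n} (suc i , c) (suc j , d) → Adj (i , c) (j , d)
Adj-pred (inj₁ (i≡j , c≢d))        = inj₁ (Fin.suc-injective i≡j , c≢d)
Adj-pred (inj₂ (inj₁ (j≡1+i , e))) = inj₂ (inj₁ (ℕ.suc-injective j≡1+i , e))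
Adj-pred (inj₂ (inj₂ (i≡1+j , e))) = inj₂ (inj₂ (ℕ.suc-injective i≡1+j , e))

module _ {n} (s : Subset 3) (χ : VSet n) where

  IsConfiguration-∷⁻ : IsConfiguration (s ∷ χ) → AtMostOne s × CanPrecede s χ × IsConfiguration χ
  IsConfiguration-∷⁻ conf = atMostOne , canPrecede χ conf , tailConf
    where
    atMostOne : AtMostOne s
    atMostOne c d c∈s d∈s with c Fin.≟ d
    ... | yes c≡d = c≡d
    ... | no  c≢d = ⊥-elim (conf (zero , c) (zero , d) c∈s d∈s (inj₁ (refl , c≢d)))
    canPrecede : ∀ {m} (χ : VSet m) → IsConfiguration (s ∷ χ) → CanPrecede s χ
    canPrecede []      _     = tt
    canPrecede (t ∷ _) conf′ c d c∈s d∈t e =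
      conf′ (zero , c) (suc zero , d) c∈s d∈t (inj₂ (inj₁ (refl , e)))
    tailConf : IsConfiguration χ
    tailConf (i , c) (j , d) u∈χ v∈χ adj = conf (suc i , c) (suc j , d) u∈χ v∈χ (Adj-suc adj)

  IsConfiguration-∷⁺ : AtMostOne s × CanPrecede s χ × IsConfiguration χ → IsConfiguration (s ∷ χ)
  IsConfiguration-∷⁺ (atMostOne , noForwardEdge , conf) = go χ noForwardEdge conf
    where
    go : ∀ {m} (χ : VSet m) → CanPrecede s χ → IsConfiguration χ → IsConfiguration (s ∷ χ)
    go χ       _  _    (zero , c)        (zero , d)        c∈ d∈ (inj₁ (_ , c≢d))    = c≢d (atMostOne c d c∈ d∈)
    go (t ∷ χ) nf _    (zero , c)        (suc zero , d)    c∈ d∈ (inj₂ (inj₁ (_ , e))) = nf c d c∈ d∈ e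
    go (t ∷ χ) nf _    (suc zero , c)    (zero , d)        c∈ d∈ (inj₂ (inj₂ (_ , e))) = nf d c d∈ c∈ e
    go χ       _  conf (suc i , c)       (suc j , d)       c∈ d∈ adj = conf (i , c) (j , d) c∈ d∈ (Adj-pred adj)
    go χ       _  _    (zero , _)        (zero , _)        _  _  (inj₂ (inj₁ (() , _)))
    go χ       _  _    (zero , _)        (zero , _)        _  _  (inj₂ (inj₂ (() , _)))
    go χ       _  _    (zero , _)        (suc _ , _)       _  _  (inj₁ (() , _))
    go χ       _  _    (zero , _)        (suc (suc _) , _) _  _  (inj₂ (inj₁ (() , _)))
    go χ       _  _    (zero , _)        (suc _ , _)       _  _  (inj₂ (inj₂ (() , _)))
    go χ       _  _    (suc _ , _)       (zero , _)        _  _  (inj₁ (() , _))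
    go χ       _  _    (suc _ , _)       (zero , _)        _  _  (inj₂ (inj₁ (() , _)))
    go χ       _  _    (suc (suc _) , _) (zero , _)        _  _  (inj₂ (inj₂ (() , _)))

  IsConfiguration-∷ : IsConfiguration (s ∷ χ) ⇔ (AtMostOne s × CanPrecede s χ × IsConfiguration χ)
  IsConfiguration-∷ = mk⇔ IsConfiguration-∷⁻ IsConfiguration-∷⁺

Continues : ∀ {n} → Subset 3 → VSet n → Set
Continues s χ = CanPrecede s χ × IsConfiguration χ

continues? : ∀ {n} s (χ : VSet n) → Dec (Continues s χ)
continues? s χ = canPrecede? s χ ×-dec isConfiguration? χ

Successor : Subset 3 → Subset 3 → Set
Successor s t = NoForwardEdge s t × AtMostOne t

successor? : ∀ s t → Dec (Successor s t)
successor? s t = noForwardEdge? s t ×-dec atMostOne? t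

E3-after : Subset 3 → ℕ → ℤ
E3-after s n = ∑ (filter (continues? s) (allVSets n)) (sign ∘ size)

E3≡E3-after-∅ : ∀ n → E3 n ≡ E3-after ∅ n
E3≡E3-after-∅ n = begin
  ∑ (filter isConfiguration? (allVSets n)) (sign ∘ size)
    ≡⟨ ∑-filter isConfiguration? (sign ∘ size) (allVSets n) ⟩
  ∑ (allVSets n) (λ χ → if does (isConfiguration? χ) then sign (size χ) else 0ℤ)
    ≡⟨ ∑-cong (allVSets n) (λ χ → cong (λ b → if b ∧ does (isConfiguration? χ) then sign (size χ) else 0ℤ)
                                     (sym (dec-true (canPrecede? ∅ χ) (∅-canPrecede χ)))) ⟩
  ∑ (allVSets n) (λ χ → if does (continues? ∅ χ) then sign (size χ) else 0ℤ)
    ≡⟨ ∑-filter (continues? ∅) (sign ∘ size) (allVSets n) ⟨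
  E3-after ∅ n ∎
  where open ≡-Reasoning

E3-after-suc : ∀ s n →
  E3-after s (suc n) ≡ ∑ (filter (successor? s) allSubsets3) (λ t → sign ∣ t ∣ * E3-after t n)
E3-after-suc s n = begin
  E3-after s (suc n)
    ≡⟨ ∑-filter (continues? s) (sign ∘ size) (allVSets (suc n)) ⟩
  ∑ (allVSets (suc n)) (λ χ → if does (continues? s χ) then sign (size χ) else 0ℤ)
    ≡⟨ ∑-allVecs-suc allSubsets3 n _ ⟩
  ∑ allSubsets3 (λ t → ∑ (allVSets n) (λ χ →
      if does (continues? s (t ∷ χ)) then sign (∣ t ∣ ℕ.+ size χ) else 0ℤ))
    ≡⟨ ∑-cong allSubsets3 firstColumn ⟩
  ∑ allSubsets3 (λ t → if does (successor? s t) then sign ∣ t ∣ * E3-after t n else 0ℤ)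
    ≡⟨ ∑-filter (successor? s) (λ t → sign ∣ t ∣ * E3-after t n) allSubsets3 ⟨
  ∑ (filter (successor? s) allSubsets3) (λ t → sign ∣ t ∣ * E3-after t n) ∎
  where
  open ≡-Reasoning
  firstColumn : ∀ t →
    ∑ (allVSets n) (λ χ → if does (continues? s (t ∷ χ)) then sign (∣ t ∣ ℕ.+ size χ) else 0ℤ)
      ≡ (if does (successor? s t) then sign ∣ t ∣ * E3-after t n else 0ℤ)
  firstColumn t = begin
    ∑ (allVSets n) (λ χ → if does (continues? s (t ∷ χ)) then sign (∣ t ∣ ℕ.+ size χ) else 0ℤ)
      ≡⟨ ∑-cong (allVSets n) splitGuard ⟩
    ∑ (allVSets n) (λ χ → if does (successor? s t) then sign ∣ t ∣ * tailTerm χ else 0ℤ)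
      ≡⟨ ∑-if (does (successor? s t)) (λ χ → sign ∣ t ∣ * tailTerm χ) (allVSets n) ⟩
    (if does (successor? s t) then ∑ (allVSets n) (λ χ → sign ∣ t ∣ * tailTerm χ) else 0ℤ)
      ≡⟨ cong (λ z → if does (successor? s t) then z else 0ℤ) (∑-*ˡ (sign ∣ t ∣) tailTerm (allVSets n)) ⟩
    (if does (successor? s t) then sign ∣ t ∣ * ∑ (allVSets n) tailTerm else 0ℤ)
      ≡⟨ cong (λ z → if does (successor? s t) then sign ∣ t ∣ * z else 0ℤ)
              (∑-filter (continues? t) (sign ∘ size) (allVSets n)) ⟨
    (if does (successor? s t) then sign ∣ t ∣ * E3-after t n else 0ℤ) ∎
    where
    tailTerm : VSet n → ℤ
    tailTerm χ = if does (continues? t χ) then sign (size χ) else 0ℤ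
    splitGuard : ∀ χ → (if does (continues? s (t ∷ χ)) then sign (∣ t ∣ ℕ.+ size χ) else 0ℤ)
                       ≡ (if does (successor? s t) then sign ∣ t ∣ * tailTerm χ else 0ℤ)
    splitGuard χ
      rewrite does-⇔ (IsConfiguration-∷ t χ) (isConfiguration? (t ∷ χ)) (atMostOne? t ×-dec continues? t χ)
            | sign-+ ∣ t ∣ (size χ)
      = if-∧-* (does (noForwardEdge? s t)) (does (atMostOne? t)) (does (continues? t χ)) (sign ∣ t ∣) (sign (size χ))

x y z : Subset 3
x = ⁅ zero ⁆
y = ⁅ suc zero ⁆
z = ⁅ suc (suc zero) ⁆

-- Each regroup has as left side the sum of E3-after-suc, evaluated: in the
-- enumeration order of allSubsets3 the successors of ∅ are ∅, z, y, x, and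
-- those of ⁅ c ⁆ are ∅ and ⁅ next (next c) ⁆.
E3-after-∅-suc : ∀ n → E3-after ∅ (suc n) ≡ E3-after ∅ n - E3-after x n - E3-after y n - E3-after z n
E3-after-∅-suc n =
  trans (E3-after-suc ∅ n) (regroup (E3-after ∅ n) (E3-after x n) (E3-after y n) (E3-after z n))
  where
  regroup : ∀ a b c d → + 1 * a + (-1ℤ * d + (-1ℤ * c + (-1ℤ * b + 0ℤ))) ≡ a - b - c - d
  regroup = solve-∀

E3-after-⁅⁆-suc : ∀ c n → E3-after ⁅ c ⁆ (suc n) ≡ E3-after ∅ n - E3-after ⁅ next (next c) ⁆ n
E3-after-⁅⁆-suc c n = trans (E3-after-suc ⁅ c ⁆ n) (successors c)
  where
  regroup : ∀ a b → + 1 * a + (-1ℤ * b + 0ℤ) ≡ a - b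
  regroup = solve-∀
  successors : ∀ c → ∑ (filter (successor? ⁅ c ⁆) allSubsets3) (λ t → sign ∣ t ∣ * E3-after t n)
                     ≡ E3-after ∅ n - E3-after ⁅ next (next c) ⁆ n
  successors zero             = regroup (E3-after ∅ n) (E3-after z n)
  successors (suc zero)       = regroup (E3-after ∅ n) (E3-after x n)
  successors (suc (suc zero)) = regroup (E3-after ∅ n) (E3-after y n)

E3-suc-suc : ∀ n → E3 (suc (suc n)) ≡ - (+ 2) * E3 n
E3-suc-suc n = begin
  E3 (suc (suc n))
    ≡⟨ E3≡E3-after-∅ (suc (suc n)) ⟩
  E3-after ∅ (suc (suc n))
    ≡⟨ E3-after-∅-suc (suc n) ⟩
  E3-after ∅ (suc n) - E3-after x (suc n) - E3-after y (suc n) - E3-after z (suc n)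
    ≡⟨ cong₂ _-_ (cong₂ _-_ (cong₂ _-_ (E3-after-∅-suc n) (E3-after-⁅⁆-suc zero n))
                            (E3-after-⁅⁆-suc (suc zero) n))
                 (E3-after-⁅⁆-suc (suc (suc zero)) n) ⟩
  (a - b - c - d) - (a - d) - (a - b) - (a - c)
    ≡⟨ cancel a b c d ⟩
  - (+ 2) * a
    ≡⟨ cong (- (+ 2) *_) (E3≡E3-after-∅ n) ⟨
  - (+ 2) * E3 n ∎
  where
  open ≡-Reasoning
  a b c d : ℤ
  a = E3-after ∅ n
  b = E3-after x n
  c = E3-after y n
  d = E3-after z n
  cancel : ∀ a b c d → (a - b - c - d) - (a - d) - (a - b) - (a - c) ≡ - (+ 2) * a
  cancel = solve-∀

E3-1 : E3 1 ≡ - (+ 2)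
E3-1 = refl

suc-suc-/2 : ∀ n → suc (suc n) / 2 ≡ suc (n / 2)
suc-suc-/2 n = ℕ.m/n≡1+[m∸n]/n {suc (suc n)} (ℕ.s≤s (ℕ.s≤s ℕ.z≤n))

E3≡[-2]^⌊[n+1]/2⌋ : ∀ n → E3 n ≡ (- (+ 2)) ^ (suc n / 2)
E3≡[-2]^⌊[n+1]/2⌋ 0             = refl
E3≡[-2]^⌊[n+1]/2⌋ 1             = E3-1
E3≡[-2]^⌊[n+1]/2⌋ (suc (suc n)) = begin
  E3 (suc (suc n))                  ≡⟨ E3-suc-suc n ⟩
  - (+ 2) * E3 n                     ≡⟨ cong (- (+ 2) *_) (E3≡[-2]^⌊[n+1]/2⌋ n) ⟩
  (- (+ 2)) ^ suc (suc n / 2)        ≡⟨ cong ((- (+ 2)) ^_) (suc-suc-/2 (suc n)) ⟨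
  (- (+ 2)) ^ (suc (suc (suc n)) / 2) ∎
  where open ≡-Reasoning

proposition5 : ∀ (n : ℕ) → n ≥ 1 →
    (E3 n ≡ E3 1 ^ (suc n / 2)) × (E3 n ≡ (- (+ 2)) ^ (suc n / 2))
proposition5 n _ = trans closedForm (cong (_^ (suc n / 2)) (sym E3-1)) , closedForm
  where
  closedForm : E3 n ≡ (- (+ 2)) ^ (suc n / 2)
  closedForm = E3≡[-2]^⌊[n+1]/2⌋ n
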